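{- Let $m,n\ge 1$ and let $K_{m,n}$ be the complete bipartite graph with parts of sizes $m$ and $n$. Let $P$ be a vertex of degree $n$ (i.e. a vertex in the part of size $m$). Then \[H_f(P)=n\mathbb{N}\cup\big(n(m-1)+\mathbb{N}\big).\]
   Context: $\mathbb{N}=\{0,1,2,\dots\}$, $n\mathbb{N}=\{nk:k\in\mathbb{N}\}$, $a+\mathbb{N}=\{a+k:k\in\mathbb{N}\}$. For a graph $G$ (finite connected multigraph without loops) let $\mathcal{M}(G)$ be the set of functions $V(G)\to\mathbb{Z}$, and for $f\in\mathcal{M}(G)$ let $\Delta f(Q)=\sum_{e=QR\in E(G)}(f(Q)-f(R))$. For $P\in V(G)$, the functional Weierstrass set is $H_f(P)=\{k\in\mathbb{N}:\exists f\in\mathcal{M}(G)\text{ with }\Delta f(P)=-k\text{ and }\Delta f(Q)\ge 0\ \forall Q\neq P\}$. -}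

module Defs where

open import Data.Nat using (ℕ; zero; suc)
open import Data.Fin using (Fin; zero; suc; splitAt)
open import Data.Sum using (_⊎_; inj₁; inj₂)
open import Data.Product using (Σ; _×_; _,_)
open import Data.Integer using (ℤ; +_; -_; _+_; _-_; _*_; _≤_)
open import Relation.Binary.PropositionalEquality using (_≡_; _≢_)

Σℤ : (N : ℕ) → (Fin N → ℤ) → ℤ
Σℤ zero    g = + 0
Σℤ (suc N) g = g zero + Σℤ N (λ i → g (suc i))

-- A finite multigraph without loops on vertex set Fin N, given by its
-- symmetric edge-multiplicity function (mult Q R = number of edges QR).
record Graph : Set where
  field
    N     : ℕ
    mult  : Fin N → Fin N → ℕ
    symm  : ∀ Q R → mult Q R ≡ mult R Q
    loopless : ∀ Q → mult Q Q ≡ 0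

open Graph public

ℳ : Graph → Set
ℳ G = Fin (N G) → ℤ

Δ : (G : Graph) → ℳ G → Fin (N G) → ℤ
Δ G f Q = Σℤ (N G) (λ R → (+ mult G Q R) * (f Q - f R))

InHf : (G : Graph) → Fin (N G) → ℕ → Set
InHf G P k = Σ (ℳ G) λ f → (Δ G f P ≡ - (+ k)) × (∀ Q → Q ≢ P → + 0 ≤ Δ G f Q)

-- Complete bipartite graph K_{m,n} on Fin (m + n):
-- vertices i ↑ˡ n (i : Fin m) form the part of size m,
-- vertices m ↑ʳ j (j : Fin n) form the part of size n.
Kmult : (m n : ℕ) → Fin (m Data.Nat.+ n) → Fin (m Data.Nat.+ n) → ℕ
Kmult m n Q R with splitAt m Q | splitAt m R
... | inj₁ _ | inj₂ _ = 1
... | inj₂ _ | inj₁ _ = 1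
... | inj₁ _ | inj₁ _ = 0
... | inj₂ _ | inj₂ _ = 0

open import Relation.Binary.PropositionalEquality using (refl)

Kmult-symm : ∀ m n Q R → Kmult m n Q R ≡ Kmult m n R Q
Kmult-symm m n Q R with splitAt m Q | splitAt m R
... | inj₁ _ | inj₂ _ = refl
... | inj₂ _ | inj₁ _ = refl
... | inj₁ _ | inj₁ _ = refl
... | inj₂ _ | inj₂ _ = refl

Kmult-loop : ∀ m n Q → Kmult m n Q Q ≡ 0
Kmult-loop m n Q with splitAt m Q
... | inj₁ _ = refl
... | inj₂ _ = refl

K : ℕ → ℕ → Graph
K m n = record { N = m Data.Nat.+ n ; mult = Kmult m n
               ; symm = Kmult-symm m n ; loopless = Kmult-loop m n }

-- Since Δ is unchanged by adding a constant, we may assume f(P) = 0; then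
-- Δf(P) = -Σ_B f, every other vertex A of P's part needs n f(A) ≥ Σ_B f = k,
-- and every vertex B of the other part needs m f(B) ≥ Σ_A f.  If
-- nq < k < n(q+1) with q + 2 ≤ m, the first condition forces f ≥ q+1 on
-- A∖{P}, hence m f(B) ≥ (m-1)(q+1) > mq, so f ≥ q+1 on B as well and
-- k = Σ_B f ≥ n(q+1), a contradiction.  Conversely, for k = tn take f = t
-- off P, and for k = nb + s ≥ n(m-1) with s < n take f = b+1 on A∖{P},
-- f = b on B except one vertex with value b + s.
module Submission where

open import Defs
open import Data.Nat using (ℕ; _*_; _∸_; _≤_)
open import Data.Nat.Divisibility using (_∣_)
open import Data.Fin using (Fin; _↑ˡ_)
open import Data.Sum using (_⊎_)
open import Function.Bundles using (_⇔_)

open import Data.Nat as ℕ using (zero; suc; _+_; _<_; NonZero)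
import Data.Nat.Properties as ℕ
open import Data.Nat.DivMod using (_/_; _%_; m≡m%n+[m/n]*n; m%n<n; m/n*n≤m)
open import Data.Nat.Divisibility using (divides; _∣?_)
open import Data.Nat.Tactic.RingSolver as ℕ-Solver using ()
open import Data.Integer as ℤ using (ℤ; +_; 0ℤ; -_; +≤+; +<+)
import Data.Integer.Properties as ℤ
open import Data.Integer.Tactic.RingSolver using (solve-∀)
open import Data.Fin using (zero; suc; _↑ʳ_; splitAt; join; punchIn; punchOut)
open import Data.Fin.Properties
  using (splitAt-↑ˡ; splitAt-↑ʳ; join-splitAt; ↑ˡ-injective; punchInᵢ≢i; punchIn-punchOut)
open import Data.Vec.Functional using (insertAt; removeAt)
open import Data.Vec.Functional.Properties using (insertAt-lookup; insertAt-punchIn; removeAt-insertAt)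
open import Algebra.Properties.CommutativeMonoid.Sum ℤ.+-0-commutativeMonoid using (sum; sum-remove)
open import Data.Sum using (inj₁; inj₂; [_,_]; [_,_]′)
open import Data.Empty using (⊥; ⊥-elim)
open import Data.Product using (_,_)
open import Function using (_∘_)
open import Function.Bundles using (mk⇔)
open import Relation.Nullary using (¬_; yes; no)
open import Relation.Binary.PropositionalEquality
  using (_≡_; _≢_; refl; sym; trans; cong; cong₂; subst; subst₂; module ≡-Reasoning)

open ≡-Reasoning

Σℤ≡sum : ∀ M (g : Fin M → ℤ) → Σℤ M g ≡ sum g
Σℤ≡sum zero    g = refl
Σℤ≡sum (suc M) g = cong (ℤ._+_ (g zero)) (Σℤ≡sum M (g ∘ suc))

Σℤ-cong : ∀ M {g h : Fin M → ℤ} → (∀ i → g i ≡ h i) → Σℤ M g ≡ Σℤ M h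
Σℤ-cong zero    g≗h = refl
Σℤ-cong (suc M) g≗h = cong₂ ℤ._+_ (g≗h zero) (Σℤ-cong M (g≗h ∘ suc))

Σℤ-const : ∀ M c → Σℤ M (λ _ → c) ≡ + M ℤ.* c
Σℤ-const zero    c = sym (ℤ.*-zeroˡ c)
Σℤ-const (suc M) c = begin
  c ℤ.+ Σℤ M (λ _ → c)     ≡⟨ cong (ℤ._+_ c) (Σℤ-const M c) ⟩
  c ℤ.+ + M ℤ.* c          ≡⟨ cong (ℤ._+ + M ℤ.* c) (ℤ.*-identityˡ c) ⟨
  ℤ.1ℤ ℤ.* c ℤ.+ + M ℤ.* c ≡⟨ ℤ.*-distribʳ-+ c ℤ.1ℤ (+ M) ⟨
  + suc M ℤ.* c            ∎

Σℤ-const-minus : ∀ M c (h : Fin M → ℤ) → Σℤ M (λ i → c ℤ.- h i) ≡ + M ℤ.* c ℤ.- Σℤ M h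
Σℤ-const-minus zero    c h = sym (ℤ.*-zeroˡ c)
Σℤ-const-minus (suc M) c h =
  trans (cong (ℤ._+_ (c ℤ.- h zero)) (Σℤ-const-minus M c (h ∘ suc))) (regroup c (+ M) (h zero) _)
  where
  regroup : ∀ c x a s → c ℤ.- a ℤ.+ (x ℤ.* c ℤ.- s) ≡ (ℤ.1ℤ ℤ.+ x) ℤ.* c ℤ.- (a ℤ.+ s)
  regroup = solve-∀

Σℤ-weight-0 : ∀ M (w : Fin M → ℕ) (d : Fin M → ℤ) → (∀ i → w i ≡ 0) →
              Σℤ M (λ i → + w i ℤ.* d i) ≡ 0ℤ
Σℤ-weight-0 zero    w d w≡0 = refl
Σℤ-weight-0 (suc M) w d w≡0 =
  cong₂ ℤ._+_ (trans (cong (λ a → + a ℤ.* d zero) (w≡0 zero)) (ℤ.*-zeroˡ (d zero)))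
              (Σℤ-weight-0 M (w ∘ suc) (d ∘ suc) (w≡0 ∘ suc))

Σℤ-weight-1 : ∀ M (w : Fin M → ℕ) (d : Fin M → ℤ) → (∀ i → w i ≡ 1) →
              Σℤ M (λ i → + w i ℤ.* d i) ≡ Σℤ M d
Σℤ-weight-1 M w d w≡1 =
  Σℤ-cong M λ i → trans (cong (λ a → + a ℤ.* d i) (w≡1 i)) (ℤ.*-identityˡ (d i))

Σℤ-mono-≤ : ∀ M {g h : Fin M → ℤ} → (∀ i → g i ℤ.≤ h i) → Σℤ M g ℤ.≤ Σℤ M h
Σℤ-mono-≤ zero    g≤h = ℤ.≤-refl
Σℤ-mono-≤ (suc M) g≤h = ℤ.+-mono-≤ (g≤h zero) (Σℤ-mono-≤ M (g≤h ∘ suc))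

Σℤ-≥-const : ∀ M {c} {g : Fin M → ℤ} → (∀ i → c ℤ.≤ g i) → + M ℤ.* c ℤ.≤ Σℤ M g
Σℤ-≥-const M {c} {g} c≤g = subst (ℤ._≤ Σℤ M g) (Σℤ-const M c) (Σℤ-mono-≤ M c≤g)

Σℤ-split : ∀ m n (g : Fin (m + n) → ℤ) →
           Σℤ (m + n) g ≡ Σℤ m (g ∘ (_↑ˡ n)) ℤ.+ Σℤ n (g ∘ (m ↑ʳ_))
Σℤ-split zero    n g = sym (ℤ.+-identityˡ _)
Σℤ-split (suc m) n g =
  trans (cong (ℤ._+_ (g zero)) (Σℤ-split m n (g ∘ suc))) (sym (ℤ.+-assoc (g zero) _ _))

Σℤ-removeAt-0 : ∀ M (g : Fin (suc M) → ℤ) i → g i ≡ 0ℤ → Σℤ (suc M) g ≡ Σℤ M (removeAt g i)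
Σℤ-removeAt-0 M g i gi≡0 = begin
  Σℤ (suc M) g                  ≡⟨ Σℤ≡sum (suc M) g ⟩
  sum g                         ≡⟨ sum-remove g ⟩
  g i ℤ.+ sum (removeAt g i)    ≡⟨ cong₂ ℤ._+_ gi≡0 (sym (Σℤ≡sum M (removeAt g i))) ⟩
  0ℤ ℤ.+ Σℤ M (removeAt g i)    ≡⟨ ℤ.+-identityˡ _ ⟩
  Σℤ M (removeAt g i)           ∎

Δ-shift : ∀ G (f : ℳ G) c Q → Δ G (λ R → f R ℤ.- c) Q ≡ Δ G f Q
Δ-shift G f c Q = Σℤ-cong (N G) λ R → cong (+ mult G Q R ℤ.*_) (cancel (f Q) (f R) c)
  where
  cancel : ∀ a b c → a ℤ.- c ℤ.- (b ℤ.- c) ≡ a ℤ.- b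
  cancel = solve-∀

↑ʳ≢↑ˡ : ∀ m n (j : Fin n) (i : Fin m) → m ↑ʳ j ≢ i ↑ˡ n
↑ʳ≢↑ˡ m n j i eq with trans (sym (splitAt-↑ʳ m n j)) (trans (cong (splitAt m) eq) (splitAt-↑ˡ m i n))
... | ()

↑-elim : ∀ m n (C : Fin (m + n) → Set) →
         (∀ i → C (i ↑ˡ n)) → (∀ j → C (m ↑ʳ j)) → ∀ Q → C Q
↑-elim m n C left right Q =
  subst C (join-splitAt m n Q) ([_,_] {C = C ∘ join m n} left right (splitAt m Q))

Kmult-↑ˡ-↑ˡ : ∀ m n i i′ → Kmult m n (i ↑ˡ n) (i′ ↑ˡ n) ≡ 0
Kmult-↑ˡ-↑ˡ m n i i′ rewrite splitAt-↑ˡ m i n | splitAt-↑ˡ m i′ n = refl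

Kmult-↑ˡ-↑ʳ : ∀ m n i j → Kmult m n (i ↑ˡ n) (m ↑ʳ j) ≡ 1
Kmult-↑ˡ-↑ʳ m n i j rewrite splitAt-↑ˡ m i n | splitAt-↑ʳ m n j = refl

Kmult-↑ʳ-↑ˡ : ∀ m n j i → Kmult m n (m ↑ʳ j) (i ↑ˡ n) ≡ 1
Kmult-↑ʳ-↑ˡ m n j i rewrite splitAt-↑ʳ m n j | splitAt-↑ˡ m i n = refl

Kmult-↑ʳ-↑ʳ : ∀ m n j j′ → Kmult m n (m ↑ʳ j) (m ↑ʳ j′) ≡ 0
Kmult-↑ʳ-↑ʳ m n j j′ rewrite splitAt-↑ʳ m n j | splitAt-↑ʳ m n j′ = refl

Δ-K-↑ˡ : ∀ m n (f : ℳ (K m n)) i →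
         Δ (K m n) f (i ↑ˡ n) ≡ + n ℤ.* f (i ↑ˡ n) ℤ.- Σℤ n (f ∘ (m ↑ʳ_))
Δ-K-↑ˡ m n f i = begin
  Δ (K m n) f Q
    ≡⟨ Σℤ-split m n _ ⟩
  Σℤ m (λ i′ → + Kmult m n Q (i′ ↑ˡ n) ℤ.* (f Q ℤ.- f (i′ ↑ˡ n)))
    ℤ.+ Σℤ n (λ j → + Kmult m n Q (m ↑ʳ j) ℤ.* (f Q ℤ.- f (m ↑ʳ j)))
    ≡⟨ cong₂ ℤ._+_ (Σℤ-weight-0 m _ _ (Kmult-↑ˡ-↑ˡ m n i)) (Σℤ-weight-1 n _ _ (Kmult-↑ˡ-↑ʳ m n i)) ⟩
  0ℤ ℤ.+ Σℤ n (λ j → f Q ℤ.- f (m ↑ʳ j))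
    ≡⟨ ℤ.+-identityˡ _ ⟩
  Σℤ n (λ j → f Q ℤ.- f (m ↑ʳ j))
    ≡⟨ Σℤ-const-minus n (f Q) _ ⟩
  + n ℤ.* f Q ℤ.- Σℤ n (f ∘ (m ↑ʳ_))
    ∎
  where Q = i ↑ˡ n

Δ-K-↑ʳ : ∀ m n (f : ℳ (K m n)) j →
         Δ (K m n) f (m ↑ʳ j) ≡ + m ℤ.* f (m ↑ʳ j) ℤ.- Σℤ m (f ∘ (_↑ˡ n))
Δ-K-↑ʳ m n f j = begin
  Δ (K m n) f Q
    ≡⟨ Σℤ-split m n _ ⟩
  Σℤ m (λ i → + Kmult m n Q (i ↑ˡ n) ℤ.* (f Q ℤ.- f (i ↑ˡ n)))
    ℤ.+ Σℤ n (λ j′ → + Kmult m n Q (m ↑ʳ j′) ℤ.* (f Q ℤ.- f (m ↑ʳ j′)))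
    ≡⟨ cong₂ ℤ._+_ (Σℤ-weight-1 m _ _ (Kmult-↑ʳ-↑ˡ m n j)) (Σℤ-weight-0 n _ _ (Kmult-↑ʳ-↑ʳ m n j)) ⟩
  Σℤ m (λ i → f Q ℤ.- f (i ↑ˡ n)) ℤ.+ 0ℤ
    ≡⟨ ℤ.+-identityʳ _ ⟩
  Σℤ m (λ i → f Q ℤ.- f (i ↑ˡ n))
    ≡⟨ Σℤ-const-minus m (f Q) _ ⟩
  + m ℤ.* f Q ℤ.- Σℤ m (f ∘ (_↑ˡ n))
    ∎
  where Q = m ↑ʳ j

Δ-K-vanishing : ∀ m n (f : ℳ (K m n)) i → f (i ↑ˡ n) ≡ 0ℤ →
                Δ (K m n) f (i ↑ˡ n) ≡ - Σℤ n (f ∘ (m ↑ʳ_))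
Δ-K-vanishing m n f i fi≡0 =
  trans (Δ-K-↑ˡ m n f i) (trans (cong (λ x → + n ℤ.* x ℤ.- Σℤ n (f ∘ (m ↑ʳ_))) fi≡0) (eval (+ n) _))
  where
  eval : ∀ x s → x ℤ.* 0ℤ ℤ.- s ≡ - s
  eval = solve-∀

-- A function on K (1 + m′) n vanishing at P, given by its values `right`
-- on the part of size n and `left` on the m′ other vertices of P's part
-- (listed by punchIn).  Then Δ f(P) = - Σ right, and the two bounds say
-- that Δ f ≥ 0 on P's part and on the other part respectively.
record Certificate (m′ n k : ℕ) : Set where
  field
    right         : Fin n → ℤ
    left          : Fin m′ → ℤ
    Σright≡k      : Σℤ n right ≡ + k
    k≤n*left      : ∀ i → + k ℤ.≤ + n ℤ.* left i
    Σleft≤m*right : ∀ j → Σℤ m′ left ℤ.≤ + suc m′ ℤ.* right j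

InHf⇒Certificate : ∀ {m′ n k} (i₀ : Fin (suc m′)) →
                   InHf (K (suc m′) n) (i₀ ↑ˡ n) k → Certificate m′ n k
InHf⇒Certificate {m′} {n} {k} i₀ (f , Δf[P]≡-k , Δf≥0) = record
  { right         = right
  ; left          = left
  ; Σright≡k      = Σright≡k
  ; k≤n*left      = k≤n*left
  ; Σleft≤m*right = Σleft≤m*right
  }
  where
  m = suc m′
  P = i₀ ↑ˡ n
  g : ℳ (K m n)
  g R = f R ℤ.- f P
  g[P]≡0 : g P ≡ 0ℤ
  g[P]≡0 = ℤ.+-inverseʳ (f P)
  Δg≡Δf : ∀ Q → Δ (K m n) g Q ≡ Δ (K m n) f Q
  Δg≡Δf = Δ-shift (K m n) f (f P)
  right : Fin n → ℤ
  right = g ∘ (m ↑ʳ_)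
  left : Fin m′ → ℤ
  left = removeAt (g ∘ (_↑ˡ n)) i₀
  Σright≡k : Σℤ n right ≡ + k
  Σright≡k = ℤ.neg-injective (trans (sym (Δ-K-vanishing m n g i₀ g[P]≡0)) (trans (Δg≡Δf P) Δf[P]≡-k))
  k≤n*left : ∀ i → + k ℤ.≤ + n ℤ.* left i
  k≤n*left i = ℤ.0≤i-j⇒j≤i (subst (0ℤ ℤ.≤_) Δf≡ (Δf≥0 Q (punchInᵢ≢i i₀ i ∘ ↑ˡ-injective n _ i₀)))
    where
    Q = punchIn i₀ i ↑ˡ n
    Δf≡ : Δ (K m n) f Q ≡ + n ℤ.* left i ℤ.- + k
    Δf≡ = trans (sym (Δg≡Δf Q)) (trans (Δ-K-↑ˡ m n g (punchIn i₀ i)) (cong (ℤ._-_ (+ n ℤ.* left i)) Σright≡k))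
  Σleft≤m*right : ∀ j → Σℤ m′ left ℤ.≤ + m ℤ.* right j
  Σleft≤m*right j = ℤ.0≤i-j⇒j≤i (subst (0ℤ ℤ.≤_) Δf≡ (Δf≥0 Q (↑ʳ≢↑ˡ m n j i₀)))
    where
    Q = m ↑ʳ j
    Δf≡ : Δ (K m n) f Q ≡ + m ℤ.* right j ℤ.- Σℤ m′ left
    Δf≡ = trans (sym (Δg≡Δf Q))
            (trans (Δ-K-↑ʳ m n g j) (cong (ℤ._-_ (+ m ℤ.* right j)) (Σℤ-removeAt-0 m′ (g ∘ (_↑ˡ n)) i₀ g[P]≡0)))

Certificate⇒InHf : ∀ {m′ n k} (i₀ : Fin (suc m′)) →
                   Certificate m′ n k → InHf (K (suc m′) n) (i₀ ↑ˡ n) k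
Certificate⇒InHf {m′} {n} {k} i₀ c = f , Δf[P]≡-k , ↑-elim m n _ Δf[left]≥0 Δf[right]≥0
  where
  open Certificate c
  m = suc m′
  P = i₀ ↑ˡ n
  fˡ : Fin m → ℤ
  fˡ = insertAt left i₀ 0ℤ
  f : ℳ (K m n)
  f = [ fˡ , right ]′ ∘ splitAt m
  f∘↑ˡ : ∀ i → f (i ↑ˡ n) ≡ fˡ i
  f∘↑ˡ i = cong [ fˡ , right ]′ (splitAt-↑ˡ m i n)
  f∘↑ʳ : ∀ j → f (m ↑ʳ j) ≡ right j
  f∘↑ʳ j = cong [ fˡ , right ]′ (splitAt-↑ʳ m n j)
  f[P]≡0 : f P ≡ 0ℤ
  f[P]≡0 = trans (f∘↑ˡ i₀) (insertAt-lookup left i₀ 0ℤ)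
  Σf∘↑ʳ≡k : Σℤ n (f ∘ (m ↑ʳ_)) ≡ + k
  Σf∘↑ʳ≡k = trans (Σℤ-cong n f∘↑ʳ) Σright≡k
  Δf[P]≡-k : Δ (K m n) f P ≡ - + k
  Δf[P]≡-k = trans (Δ-K-vanishing m n f i₀ f[P]≡0) (cong -_ Σf∘↑ʳ≡k)
  Δf[left]≥0 : ∀ i → i ↑ˡ n ≢ P → 0ℤ ℤ.≤ Δ (K m n) f (i ↑ˡ n)
  Δf[left]≥0 i i↑≢P = subst (0ℤ ℤ.≤_) (sym Δf≡) (ℤ.i≤j⇒0≤j-i (k≤n*left (punchOut i₀≢i)))
    where
    i₀≢i : i₀ ≢ i
    i₀≢i = i↑≢P ∘ cong (_↑ˡ n) ∘ sym
    f[i]≡ : f (i ↑ˡ n) ≡ left (punchOut i₀≢i)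
    f[i]≡ = begin
      f (i ↑ˡ n)                                ≡⟨ f∘↑ˡ i ⟩
      fˡ i                                      ≡⟨ cong fˡ (punchIn-punchOut i₀≢i) ⟨
      fˡ (punchIn i₀ (punchOut i₀≢i))           ≡⟨ insertAt-punchIn left i₀ 0ℤ (punchOut i₀≢i) ⟩
      left (punchOut i₀≢i)                      ∎
    Δf≡ : Δ (K m n) f (i ↑ˡ n) ≡ + n ℤ.* left (punchOut i₀≢i) ℤ.- + k
    Δf≡ = trans (Δ-K-↑ˡ m n f i) (cong₂ (λ x s → + n ℤ.* x ℤ.- s) f[i]≡ Σf∘↑ʳ≡k)
  Δf[right]≥0 : ∀ j → m ↑ʳ j ≢ P → 0ℤ ℤ.≤ Δ (K m n) f (m ↑ʳ j)
  Δf[right]≥0 j _ = subst (0ℤ ℤ.≤_) (sym Δf≡) (ℤ.i≤j⇒0≤j-i (Σleft≤m*right j))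
    where
    Σf∘↑ˡ≡Σleft : Σℤ m (f ∘ (_↑ˡ n)) ≡ Σℤ m′ left
    Σf∘↑ˡ≡Σleft = begin
      Σℤ m (f ∘ (_↑ˡ n))             ≡⟨ Σℤ-removeAt-0 m′ (f ∘ (_↑ˡ n)) i₀ f[P]≡0 ⟩
      Σℤ m′ (removeAt (f ∘ (_↑ˡ n)) i₀) ≡⟨ Σℤ-cong m′ (λ i → f∘↑ˡ (punchIn i₀ i)) ⟩
      Σℤ m′ (removeAt fˡ i₀)          ≡⟨ Σℤ-cong m′ (removeAt-insertAt left i₀ 0ℤ) ⟩
      Σℤ m′ left                      ∎
    Δf≡ : Δ (K m n) f (m ↑ʳ j) ≡ + m ℤ.* right j ℤ.- Σℤ m′ left
    Δf≡ = trans (Δ-K-↑ʳ m n f j) (cong₂ (λ x s → + m ℤ.* x ℤ.- s) (f∘↑ʳ j) Σf∘↑ˡ≡Σleft)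

a*q<a*y⇒suc[q]≤y : ∀ a q {y} → + (a * q) ℤ.< + a ℤ.* y → + suc q ℤ.≤ y
a*q<a*y⇒suc[q]≤y a q {y} a*q<a*y =
  ℤ.i<j⇒suc[i]≤j (ℤ.*-cancelˡ-<-nonNeg (+ a) (subst (ℤ._< + a ℤ.* y) (ℤ.pos-* a q) a*q<a*y))

no-certificate-strictly-between : ∀ {m′ n k} q → Certificate m′ n k →
  n * q < k → k < n * suc q → q < m′ → ⊥
no-certificate-strictly-between {m′} {n} {k} q c n*q<k k<n*[1+q] q<m′ =
  ℤ.<⇒≱ (+<+ k<n*[1+q]) n*[1+q]≤k
  where
  open Certificate c
  left≥ : ∀ i → + suc q ℤ.≤ left i
  left≥ i = a*q<a*y⇒suc[q]≤y n q (ℤ.<-≤-trans (+<+ n*q<k) (k≤n*left i))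
  [1+m′]*q<m′*[1+q] : suc m′ * q < m′ * suc q
  [1+m′]*q<m′*[1+q] = subst (suc m′ * q <_) (sym (ℕ.*-suc m′ q)) (ℕ.+-monoˡ-< (m′ * q) q<m′)
  right≥ : ∀ j → + suc q ℤ.≤ right j
  right≥ j = a*q<a*y⇒suc[q]≤y (suc m′) q (ℤ.<-≤-trans (+<+ [1+m′]*q<m′*[1+q])
    (ℤ.≤-trans (subst (ℤ._≤ Σℤ m′ left) (sym (ℤ.pos-* m′ (suc q))) (Σℤ-≥-const m′ left≥)) (Σleft≤m*right j)))
  n*[1+q]≤k : + (n * suc q) ℤ.≤ + k
  n*[1+q]≤k = subst₂ ℤ._≤_ (sym (ℤ.pos-* n (suc q))) Σright≡k (Σℤ-≥-const n right≥)

n*[m/n]<m : ∀ m n .{{_ : NonZero n}} → ¬ n ∣ m → n * (m / n) < m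
n*[m/n]<m m n n∤m = ℕ.≤∧≢⇒< (subst (_≤ m) (ℕ.*-comm (m / n) n) (m/n*n≤m m n))
  (λ n*q≡m → n∤m (divides (m / n) (trans (sym n*q≡m) (ℕ.*-comm n (m / n)))))

m<n*[1+m/n] : ∀ m n .{{_ : NonZero n}} → m < n * suc (m / n)
m<n*[1+m/n] m n =
  subst₂ _<_ (sym (m≡m%n+[m/n]*n m n)) n+q*n≡n*[1+q] (ℕ.+-monoˡ-< (m / n * n) (m%n<n m n))
  where
  n+q*n≡n*[1+q] : n + m / n * n ≡ n * suc (m / n)
  n+q*n≡n*[1+q] = trans (cong (_+_ n) (ℕ.*-comm (m / n) n)) (sym (ℕ.*-suc n (m / n)))

certificate⇒ : ∀ {m′ n k} .{{_ : NonZero n}} → Certificate m′ n k → n ∣ k ⊎ n * m′ ≤ k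
certificate⇒ {m′} {n} {k} c with n ∣? k | n * m′ ℕ.≤? k
... | yes n∣k | _          = inj₁ n∣k
... | no _    | yes n*m′≤k = inj₂ n*m′≤k
... | no n∤k  | no n*m′≰k  =
  ⊥-elim (no-certificate-strictly-between (k / n) c (n*[m/n]<m k n n∤k) (m<n*[1+m/n] k n) q<m′)
  where
  q<m′ : k / n < m′
  q<m′ = ℕ.≰⇒> λ m′≤q → n*m′≰k (ℕ.≤-trans (ℕ.*-monoʳ-≤ n m′≤q) (ℕ.<⇒≤ (n*[m/n]<m k n n∤k)))

uniformCertificate : ∀ {m′ n′ k} a b s → suc n′ * b + s ≡ k → k ≤ suc n′ * a →
                     m′ * a ≤ suc m′ * b → Certificate m′ (suc n′) k
uniformCertificate {m′} {n′} {k} a b s n*b+s≡k k≤n*a m′*a≤m*b = record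
  { right         = right
  ; left          = λ _ → + a
  ; Σright≡k      = begin
      + (b + s) ℤ.+ Σℤ n′ (λ _ → + b)   ≡⟨ cong (ℤ._+_ (+ (b + s))) (trans (Σℤ-const n′ (+ b)) (sym (ℤ.pos-* n′ b))) ⟩
      + (b + s + n′ * b)                 ≡⟨ cong +_ (trans (regroup b s n′) n*b+s≡k) ⟩
      + k                                ∎
  ; k≤n*left      = λ _ → subst (+ k ℤ.≤_) (ℤ.pos-* (suc n′) a) (+≤+ k≤n*a)
  ; Σleft≤m*right = λ j → subst₂ ℤ._≤_ (trans (ℤ.pos-* m′ a) (sym (Σℤ-const m′ (+ a)))) (ℤ.pos-* (suc m′) _)
      (+≤+ (ℕ.≤-trans m′*a≤m*b (ℕ.*-monoʳ-≤ (suc m′) (b≤right j))))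
  }
  where
  rightℕ : Fin (suc n′) → ℕ
  rightℕ zero    = b + s
  rightℕ (suc _) = b
  right : Fin (suc n′) → ℤ
  right = +_ ∘ rightℕ
  b≤right : ∀ j → b ≤ rightℕ j
  b≤right zero    = ℕ.m≤m+n b s
  b≤right (suc _) = ℕ.≤-refl
  regroup : ∀ b s n′ → b + s + n′ * b ≡ suc n′ * b + s
  regroup = ℕ-Solver.solve-∀

multipleCertificate : ∀ {m′ n′ k} → suc n′ ∣ k → Certificate m′ (suc n′) k
multipleCertificate {m′} {n′} (divides t refl) =
  uniformCertificate t t 0 (trans (ℕ.+-identityʳ _) (ℕ.*-comm (suc n′) t))
    (ℕ.≤-reflexive (ℕ.*-comm t (suc n′))) (ℕ.m≤n+m (m′ * t) t)

largeCertificate : ∀ {m′ n′ k} → suc n′ * m′ ≤ k → Certificate m′ (suc n′) k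
largeCertificate {m′} {n′} {k} n*m′≤k =
  uniformCertificate (suc q) q (k % n) n*q+r≡k (ℕ.<⇒≤ (m<n*[1+m/n] k n)) m′*[1+q]≤[1+m′]*q
  where
  n = suc n′
  q = k / n
  n*q+r≡k : n * q + k % n ≡ k
  n*q+r≡k = trans (cong (_+ k % n) (ℕ.*-comm n q))
                  (trans (ℕ.+-comm (q * n) (k % n)) (sym (m≡m%n+[m/n]*n k n)))
  m′≤q : m′ ≤ q
  m′≤q = ℕ.≮⇒≥ λ q<m′ → ℕ.<⇒≱ (m<n*[1+m/n] k n) (ℕ.≤-trans (ℕ.*-monoʳ-≤ n q<m′) n*m′≤k)
  m′*[1+q]≤[1+m′]*q : m′ * suc q ≤ suc m′ * q
  m′*[1+q]≤[1+m′]*q = subst (_≤ suc m′ * q) (sym (ℕ.*-suc m′ q)) (ℕ.+-monoˡ-≤ (m′ * q) m′≤q)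

lemma3p9 : (m n : ℕ) → 1 ≤ m → 1 ≤ n → (i : Fin m) → (k : ℕ) →
    InHf (K m n) (i ↑ˡ n) k ⇔ ((n ∣ k) ⊎ (n * (m ∸ 1) ≤ k))
lemma3p9 zero     _        ()  _  _ _
lemma3p9 (suc m′) zero     _   () _ _
lemma3p9 (suc m′) (suc n′) _   _  i k = mk⇔
  (certificate⇒ ∘ InHf⇒Certificate i)
  (Certificate⇒InHf i ∘ [ multipleCertificate , largeCertificate ]′)
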